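{- Let $N^{o}$ be a function on bounded constraints, and define the function $N^{i}$ on bounded constraints by $N^{i}(\phi, B) := (\widetilde{\neg}\,\phi_{N}, B_{N})$, where $(\phi_{N}, B_{N}) = N^{o}(\widetilde{\neg}\,\phi, B)$. Then $N^{o}$ is an outer narrowing operator if and only if $N^{i}$ is an inner narrowing operator.
   Context: Fix a set $V$ of variables. A (quantified) constraint is a first-order formula over the reals built from atomic constraints of the forms $f<g$, $f>g$, $f\le g$, $f\ge g$ (where $f,g$ are terms built from variables in $V$ and function symbols interpreted as real functions) using the connectives $\wedge$, $\vee$ and bounded quantifiers $\exists x\in I\;\phi$, $\forall x\in I\;\phi$, where $I$ is a closed real interval (the quantifier bound); no negation symbols occur. A variable assignment is a function $V\to\mathbb{R}$, and $[\![\phi]\!]$ denotes the set of variable assignments that make $\phi$ true (bounded quantifiers range over their bound). A box assignment is a set of variable assignments of the form $\{d : d(v)\in B(v)\text{ for all } v\in V\}$ for a map $B$ from $V$ to closed intervals; a box assignment is identified with such a map (the empty set is a box assignment). A bounded constraint is a pair $(\phi,B)$ with $\phi$ a constraint and $B$ a box assignment (its free-variable bound). The opposite $\widetilde{\neg}\,\phi$ of $\phi$ is the constraint obtained from $\neg\phi$ by pushing the negation down: swapping $\wedge$ and $\vee$, swapping $\exists x\in I$ and $\forall x\in I$, and replacing $\neg(f\le g)$ by $f>g$, $\neg(f<g)$ by $f\ge g$, $\neg(f\ge g)$ by $f<g$, $\neg(f>g)$ by $f\le g$; thus $[\![\widetilde{\neg}\,\phi]\!]$ is the complement of $[\![\phi]\!]$.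 A narrowing operator is a function $N$ on bounded constraints such that for all bounded constraints $(\phi,B)$, $(\phi',B')$ with $N(\phi,B)=(\phi_N,B_N)$ and $N(\phi',B')=(\phi'_N,B'_N)$: $B\supseteq B_N$ (contractance); $[\![\phi_N]\!]\cap B_N = [\![\phi]\!]\cap B_N$ (soundness); $B'\subseteq B$ implies $B'_N\subseteq B_N$ (monotonicity); and $N(N(\phi,B))=N(\phi,B)$ (idempotence). An outer narrowing operator is a narrowing operator $N$ such that for every bounded constraint $(\phi,B)$, the free-variable bound $B_N$ of $N(\phi,B)$ satisfies $B_N\supseteq B\cap[\![\phi]\!]$. An inner narrowing operator is a narrowing operator $N$ such that for every $(\phi,B)$, the free-variable bound $B_N$ of $N(\phi,B)$ satisfies $B_N\supseteq B\setminus[\![\phi]\!]$. -}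

module Defs where

open import Level using (0ℓ)
open import Data.Nat using (ℕ)
open import Data.Fin using (Fin)
open import Data.Product using (Σ; _×_; _,_; proj₁; proj₂)
open import Data.Sum using (_⊎_)
open import Data.Empty using (⊥)
open import Data.Maybe using (Maybe; just; nothing)
open import Data.Bool using (if_then_else_)
open import Function.Bundles using (_⇔_)
open import Relation.Binary.Bundles using (StrictTotalOrder)
open import Relation.Binary.Definitions using (DecidableEquality)
open import Relation.Binary.PropositionalEquality using (_≡_)
open import Relation.Nullary using (¬_; does)

-- The real line is modelled by an arbitrary strict total order O
-- (the reals with < are an instance); V is the fixed set of variables,
-- with decidable equality (needed to update an assignment at a bound variable).
module Constraints (O : StrictTotalOrder 0ℓ 0ℓ 0ℓ) (V : Set) (_≟V_ : DecidableEquality V) where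

  open StrictTotalOrder O using (_≈_; _<_) renaming (Carrier to ℝ)

  _≤_ : ℝ → ℝ → Set
  x ≤ y = (x < y) ⊎ (x ≈ y)

  Interval : Set
  Interval = ℝ × ℝ

  _∈I_ : ℝ → Interval → Set
  x ∈I (a , b) = (a ≤ x) × (x ≤ b)

  -- terms: variables and applications of function symbols, where a function
  -- symbol of arity n is (identified with) its interpretation, a real function
  data Term : Set where
    var : V → Term
    app : (n : ℕ) → ((Fin n → ℝ) → ℝ) → (Fin n → Term) → Term

  data Constraint : Set where
    _<ᶜ_ _>ᶜ_ _≤ᶜ_ _≥ᶜ_ : Term → Term → Constraint
    _∧ᶜ_ _∨ᶜ_ : Constraint → Constraint → Constraint
    ∃ᶜ ∀ᶜ : V → Interval → Constraint → Constraint

  Assignment : Set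
  Assignment = V → ℝ

  _[_↦_] : Assignment → V → ℝ → Assignment
  (d [ x ↦ r ]) v = if does (x ≟V v) then r else d v

  ⟦_⟧t : Term → Assignment → ℝ
  ⟦ var v ⟧t d = d v
  ⟦ app n f ts ⟧t d = f (λ i → ⟦ ts i ⟧t d)

  ⟦_⟧ : Constraint → Assignment → Set
  ⟦ f <ᶜ g ⟧ d = ⟦ f ⟧t d < ⟦ g ⟧t d
  ⟦ f >ᶜ g ⟧ d = ⟦ g ⟧t d < ⟦ f ⟧t d
  ⟦ f ≤ᶜ g ⟧ d = ⟦ f ⟧t d ≤ ⟦ g ⟧t d
  ⟦ f ≥ᶜ g ⟧ d = ⟦ g ⟧t d ≤ ⟦ f ⟧t d
  ⟦ φ ∧ᶜ ψ ⟧ d = ⟦ φ ⟧ d × ⟦ ψ ⟧ d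
  ⟦ φ ∨ᶜ ψ ⟧ d = ⟦ φ ⟧ d ⊎ ⟦ ψ ⟧ d
  ⟦ ∃ᶜ x I φ ⟧ d = Σ ℝ (λ r → (r ∈I I) × ⟦ φ ⟧ (d [ x ↦ r ]))
  ⟦ ∀ᶜ x I φ ⟧ d = (r : ℝ) → r ∈I I → ⟦ φ ⟧ (d [ x ↦ r ])

  ¬̃ : Constraint → Constraint
  ¬̃ (f <ᶜ g) = f ≥ᶜ g
  ¬̃ (f >ᶜ g) = f ≤ᶜ g
  ¬̃ (f ≤ᶜ g) = f >ᶜ g
  ¬̃ (f ≥ᶜ g) = f <ᶜ g
  ¬̃ (φ ∧ᶜ ψ) = ¬̃ φ ∨ᶜ ¬̃ ψ
  ¬̃ (φ ∨ᶜ ψ) = ¬̃ φ ∧ᶜ ¬̃ ψ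
  ¬̃ (∃ᶜ x I φ) = ∀ᶜ x I (¬̃ φ)
  ¬̃ (∀ᶜ x I φ) = ∃ᶜ x I (¬̃ φ)

  -- box assignments: nothing = the empty box; just B = product of the
  -- closed intervals B v (v ∈ V)
  Box : Set
  Box = Maybe (V → Interval)

  _∈B_ : Assignment → Box → Set
  d ∈B nothing = ⊥
  d ∈B just B = (v : V) → d v ∈I B v

  _⊆B_ : Box → Box → Set
  B ⊆B B' = (d : Assignment) → d ∈B B → d ∈B B'

  _≐B_ : Box → Box → Set
  B ≐B B' = (B ⊆B B') × (B' ⊆B B)

  BoundedConstraint : Set
  BoundedConstraint = Constraint × Box

  _≐_ : BoundedConstraint → BoundedConstraint → Set
  (φ , B) ≐ (φ' , B') = (φ ≡ φ') × (B ≐B B')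

  record IsNarrowing (N : BoundedConstraint → BoundedConstraint) : Set where
    field
      contractance : (φ : Constraint) (B : Box) → proj₂ (N (φ , B)) ⊆B B
      soundness    : (φ : Constraint) (B : Box) (d : Assignment) →
                     d ∈B proj₂ (N (φ , B)) → (⟦ proj₁ (N (φ , B)) ⟧ d ⇔ ⟦ φ ⟧ d)
      monotonicity : (φ : Constraint) (B B' : Box) → B' ⊆B B →
                     proj₂ (N (φ , B')) ⊆B proj₂ (N (φ , B))
      idempotence  : (φ : Constraint) (B : Box) → N (N (φ , B)) ≐ N (φ , B)

  record IsOuterNarrowing (N : BoundedConstraint → BoundedConstraint) : Set where
    field
      narrowing : IsNarrowing N
      outer     : (φ : Constraint) (B : Box) (d : Assignment) →
                  d ∈B B → ⟦ φ ⟧ d → d ∈B proj₂ (N (φ , B))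

  record IsInnerNarrowing (N : BoundedConstraint → BoundedConstraint) : Set where
    field
      narrowing : IsNarrowing N
      inner     : (φ : Constraint) (B : Box) (d : Assignment) →
                  d ∈B B → ¬ ⟦ φ ⟧ d → d ∈B proj₂ (N (φ , B))

  innerOf : (BoundedConstraint → BoundedConstraint) → BoundedConstraint → BoundedConstraint
  innerOf No (φ , B) = ¬̃ (proj₁ (No (¬̃ φ , B))) , proj₂ (No (¬̃ φ , B))

{-# OPTIONS --safe #-}
-- Classically ⟦ ¬̃ φ ⟧ is the complement of ⟦ φ ⟧, so soundness of N at ¬̃ φ
-- is soundness of innerOf N at φ, and outerness of N at ¬̃ φ is innerness of
-- innerOf N at φ. Contractance and monotonicity only concern boxes, which
-- innerOf leaves alone, and idempotence transfers because ¬̃ is an involution.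
-- That involution also makes innerOf involutive, which gives the converse.
module Submission where

open import Defs
open import Level using (Level; 0ℓ)
open import Axiom.ExcludedMiddle using (ExcludedMiddle)
open import Axiom.DoubleNegationElimination using (em⇒dne)
open import Data.Product using (∃; _×_; _,_; proj₁; uncurry)
open import Data.Product.Function.NonDependent.Propositional using (_×-⇔_)
open import Data.Product.Function.Dependent.Propositional using (Σ-⇔)
open import Data.Sum using (_⊎_; inj₁; inj₂; [_,_])
open import Data.Sum.Function.Propositional using (_⊎-⇔_)
open import Function using (_∘_)
open import Function.Bundles using (_⇔_; mk⇔; Equivalence)
open import Function.Construct.Composition using (_⇔-∘_)
open import Function.Construct.Identity using (↠-id; ⇔-id)
open import Function.Properties.Equivalence using (⇔-setoid)
open import Function.Related.TypeIsomorphisms using (¬-cong-⇔; →-cong-⇔)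
open import Relation.Binary.Bundles using (StrictTotalOrder)
open import Relation.Binary.Definitions using (DecidableEquality; tri<; tri≈; tri>)
open import Relation.Binary.PropositionalEquality
  using (_≡_; _≗_; refl; trans; cong; cong₂; subst; subst₂)
open import Relation.Nullary using (¬_; yes; no)
open import Relation.Nullary.Negation using (_¬-⊎_; contradiction)
import Relation.Binary.Reasoning.Setoid as SetoidReasoning

open Equivalence using (to; from)

module ⇔-Reasoning {ℓ : Level} = SetoidReasoning (⇔-setoid ℓ)

Π-cong-⇔ : ∀ {a b c} {A : Set a} {B : A → Set b} {C : A → Set c} →
           (∀ x → B x ⇔ C x) → ((x : A) → B x) ⇔ ((x : A) → C x)
Π-cong-⇔ B⇔C = mk⇔ (λ f x → to (B⇔C x) (f x)) (λ g x → from (B⇔C x) (g x))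

module _ {a ℓ₁ ℓ₂} (O : StrictTotalOrder a ℓ₁ ℓ₂) where
  open StrictTotalOrder O using (_<_; compare; asym; irrefl; module Eq)
  -- this _≤_ unfolds to the _≤_ of Constraints O
  open import Relation.Binary.Construct.StrictToNonStrict (StrictTotalOrder._≈_ O) _<_
    using (_≤_)

  <⇔≱ : ∀ {x y} → x < y ⇔ (¬ y ≤ x)
  <⇔≱ {x} {y} = mk⇔ (λ x<y → [ asym x<y , (λ y≈x → irrefl (Eq.sym y≈x) x<y) ]) ≱⇒<
    where
    ≱⇒< : ¬ y ≤ x → x < y
    ≱⇒< y≰x with compare x y
    ... | tri< x<y _ _ = x<y
    ... | tri≈ _ x≈y _ = contradiction (inj₂ (Eq.sym x≈y)) y≰x
    ... | tri> _ _ y<x = contradiction (inj₁ y<x) y≰x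

  ≤⇔≮ : ∀ {x y} → x ≤ y ⇔ (¬ y < x)
  ≤⇔≮ {x} {y} = mk⇔ (λ x≤y y<x → to <⇔≱ y<x x≤y) ≮⇒≤
    where
    ≮⇒≤ : ¬ y < x → x ≤ y
    ≮⇒≤ y≮x with compare x y
    ... | tri< x<y _ _ = inj₁ x<y
    ... | tri≈ _ x≈y _ = inj₂ x≈y
    ... | tri> _ _ y<x = contradiction y<x y≮x

module Classical {ℓ} (em : ExcludedMiddle ℓ) where
  private variable
    A B : Set ℓ
    P Q : A → Set ℓ

  ¬¬A⇔A : (¬ ¬ A) ⇔ A
  ¬¬A⇔A = mk⇔ (em⇒dne em) (λ a ¬a → ¬a a)

  ¬⊎¬⇔¬× : (¬ A ⊎ ¬ B) ⇔ (¬ (A × B))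
  ¬⊎¬⇔¬× {A = A} {B = B} =
    mk⇔ (λ ¬a⊎¬b (a , b) → [ (λ ¬a → ¬a a) , (λ ¬b → ¬b b) ] ¬a⊎¬b) ¬×⇒¬⊎¬
    where
    ¬×⇒¬⊎¬ : ¬ (A × B) → ¬ A ⊎ ¬ B
    ¬×⇒¬⊎¬ ¬a×b with em {A}
    ... | yes a = inj₂ (λ b → ¬a×b (a , b))
    ... | no ¬a = inj₁ ¬a

  ¬×¬⇔¬⊎ : (¬ A × ¬ B) ⇔ (¬ (A ⊎ B))
  ¬×¬⇔¬⊎ = mk⇔ (uncurry _¬-⊎_) (λ ¬a⊎b → ¬a⊎b ∘ inj₁ , ¬a⊎b ∘ inj₂)

  ∀¬⇔¬∃ : (∀ x → P x → ¬ Q x) ⇔ (¬ ∃ λ x → P x × Q x)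
  ∀¬⇔¬∃ = mk⇔ (λ h (x , p , q) → h x p q) (λ h x p q → h (x , p , q))

  ∃¬⇔¬∀ : (∃ λ x → P x × ¬ Q x) ⇔ (¬ (∀ x → P x → Q x))
  ∃¬⇔¬∀ = mk⇔ (λ (x , p , ¬q) h → ¬q (h x p))
    (λ ¬∀ → em⇒dne em λ ¬∃ → ¬∀ λ x p → em⇒dne em λ ¬q → ¬∃ (x , p , ¬q))

module Narrowing (O : StrictTotalOrder 0ℓ 0ℓ 0ℓ) (V : Set) (_≟V_ : DecidableEquality V) where
  open Constraints O V _≟V_

  ¬̃-involutive : ∀ φ → ¬̃ (¬̃ φ) ≡ φ
  ¬̃-involutive (f <ᶜ g) = refl
  ¬̃-involutive (f >ᶜ g) = refl
  ¬̃-involutive (f ≤ᶜ g) = refl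
  ¬̃-involutive (f ≥ᶜ g) = refl
  ¬̃-involutive (φ ∧ᶜ ψ) = cong₂ _∧ᶜ_ (¬̃-involutive φ) (¬̃-involutive ψ)
  ¬̃-involutive (φ ∨ᶜ ψ) = cong₂ _∨ᶜ_ (¬̃-involutive φ) (¬̃-involutive ψ)
  ¬̃-involutive (∃ᶜ x I φ) = cong (∃ᶜ x I) (¬̃-involutive φ)
  ¬̃-involutive (∀ᶜ x I φ) = cong (∀ᶜ x I) (¬̃-involutive φ)

  innerOf-involutive : ∀ N → innerOf (innerOf N) ≗ N
  innerOf-involutive N (φ , B)
    rewrite ¬̃-involutive φ | ¬̃-involutive (proj₁ (N (φ , B))) = refl

  module _ {N M : BoundedConstraint → BoundedConstraint} (N≗M : N ≗ M) where

    IsNarrowing-resp-≗ : IsNarrowing N → IsNarrowing M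
    IsNarrowing-resp-≗ n = record
      { contractance = λ φ B → subst (λ (_ , B′) → B′ ⊆B B) (N≗M (φ , B)) (contractance φ B)
      ; soundness    = λ φ B d → subst (λ (φ′ , B′) → d ∈B B′ → ⟦ φ′ ⟧ d ⇔ ⟦ φ ⟧ d)
                                       (N≗M (φ , B)) (soundness φ B d)
      ; monotonicity = λ φ B B′ B′⊆B →
                         subst₂ (λ (_ , C) (_ , C′) → C′ ⊆B C) (N≗M (φ , B)) (N≗M (φ , B′))
                                (monotonicity φ B B′ B′⊆B)
      ; idempotence  = λ φ B → subst₂ _≐_ (trans (cong N (N≗M (φ , B))) (N≗M (M (φ , B))))
                                          (N≗M (φ , B)) (idempotence φ B)
      }
      where open IsNarrowing n

    IsOuterNarrowing-resp-≗ : IsOuterNarrowing N → IsOuterNarrowing M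
    IsOuterNarrowing-resp-≗ o = record
      { narrowing = IsNarrowing-resp-≗ narrowing
      ; outer     = λ φ B d d∈B φd →
                      subst (λ (_ , B′) → d ∈B B′) (N≗M (φ , B)) (outer φ B d d∈B φd)
      }
      where open IsOuterNarrowing o

module Opposite (em : ExcludedMiddle 0ℓ) (O : StrictTotalOrder 0ℓ 0ℓ 0ℓ)
                (V : Set) (_≟V_ : DecidableEquality V) where
  open Constraints O V _≟V_
  open Narrowing O V _≟V_ using (¬̃-involutive)
  open Classical em

  ⟦¬̃⟧⇔¬⟦⟧ : ∀ φ d → ⟦ ¬̃ φ ⟧ d ⇔ (¬ ⟦ φ ⟧ d)
  ⟦¬̃⟧⇔¬⟦⟧ (f <ᶜ g) d = ≤⇔≮ O
  ⟦¬̃⟧⇔¬⟦⟧ (f >ᶜ g) d = ≤⇔≮ O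
  ⟦¬̃⟧⇔¬⟦⟧ (f ≤ᶜ g) d = <⇔≱ O
  ⟦¬̃⟧⇔¬⟦⟧ (f ≥ᶜ g) d = <⇔≱ O
  ⟦¬̃⟧⇔¬⟦⟧ (φ ∧ᶜ ψ) d = begin
    (⟦ ¬̃ φ ⟧ d ⊎ ⟦ ¬̃ ψ ⟧ d)  ≈⟨ ⟦¬̃⟧⇔¬⟦⟧ φ d ⊎-⇔ ⟦¬̃⟧⇔¬⟦⟧ ψ d ⟩
    (¬ ⟦ φ ⟧ d ⊎ ¬ ⟦ ψ ⟧ d)  ≈⟨ ¬⊎¬⇔¬× ⟩
    (¬ (⟦ φ ⟧ d × ⟦ ψ ⟧ d))  ∎
    where open ⇔-Reasoning
  ⟦¬̃⟧⇔¬⟦⟧ (φ ∨ᶜ ψ) d = begin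
    (⟦ ¬̃ φ ⟧ d × ⟦ ¬̃ ψ ⟧ d)  ≈⟨ ⟦¬̃⟧⇔¬⟦⟧ φ d ×-⇔ ⟦¬̃⟧⇔¬⟦⟧ ψ d ⟩
    (¬ ⟦ φ ⟧ d × ¬ ⟦ ψ ⟧ d)  ≈⟨ ¬×¬⇔¬⊎ ⟩
    (¬ (⟦ φ ⟧ d ⊎ ⟦ ψ ⟧ d))  ∎
    where open ⇔-Reasoning
  ⟦¬̃⟧⇔¬⟦⟧ (∃ᶜ x I φ) d = begin
    (∀ r → r ∈I I → ⟦ ¬̃ φ ⟧ (d [ x ↦ r ]))
      ≈⟨ Π-cong-⇔ (λ r → →-cong-⇔ (⇔-id _) (⟦¬̃⟧⇔¬⟦⟧ φ (d [ x ↦ r ]))) ⟩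
    (∀ r → r ∈I I → ¬ ⟦ φ ⟧ (d [ x ↦ r ]))  ≈⟨ ∀¬⇔¬∃ ⟩
    (¬ (∃ λ r → r ∈I I × ⟦ φ ⟧ (d [ x ↦ r ])))  ∎
    where open ⇔-Reasoning
  ⟦¬̃⟧⇔¬⟦⟧ (∀ᶜ x I φ) d = begin
    (∃ λ r → r ∈I I × ⟦ ¬̃ φ ⟧ (d [ x ↦ r ]))
      ≈⟨ Σ-⇔ (↠-id _) (⇔-id _ ×-⇔ ⟦¬̃⟧⇔¬⟦⟧ φ _) ⟩
    (∃ λ r → r ∈I I × ¬ ⟦ φ ⟧ (d [ x ↦ r ]))  ≈⟨ ∃¬⇔¬∀ ⟩
    (¬ (∀ r → r ∈I I → ⟦ φ ⟧ (d [ x ↦ r ])))  ∎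
    where open ⇔-Reasoning

  ¬⟦¬̃⟧⇔⟦⟧ : ∀ φ d → (¬ ⟦ ¬̃ φ ⟧ d) ⇔ ⟦ φ ⟧ d
  ¬⟦¬̃⟧⇔⟦⟧ φ d = ¬¬A⇔A ⇔-∘ ¬-cong-⇔ (⟦¬̃⟧⇔¬⟦⟧ φ d)

  ⟦ψ⟧⇔⟦¬̃φ⟧⇒⟦¬̃ψ⟧⇔⟦φ⟧ : ∀ φ ψ d → ⟦ ψ ⟧ d ⇔ ⟦ ¬̃ φ ⟧ d → ⟦ ¬̃ ψ ⟧ d ⇔ ⟦ φ ⟧ d
  ⟦ψ⟧⇔⟦¬̃φ⟧⇒⟦¬̃ψ⟧⇔⟦φ⟧ φ ψ d ψ⇔¬̃φ = begin
    ⟦ ¬̃ ψ ⟧ d    ≈⟨ ⟦¬̃⟧⇔¬⟦⟧ ψ d ⟩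
    ¬ ⟦ ψ ⟧ d    ≈⟨ ¬-cong-⇔ ψ⇔¬̃φ ⟩
    ¬ ⟦ ¬̃ φ ⟧ d  ≈⟨ ¬⟦¬̃⟧⇔⟦⟧ φ d ⟩
    ⟦ φ ⟧ d      ∎
    where open ⇔-Reasoning

  module _ {N : BoundedConstraint → BoundedConstraint} where

    innerOf-fixes : ∀ {φ B} → N (φ , B) ≐ (φ , B) → innerOf N (¬̃ φ , B) ≐ (¬̃ φ , B)
    innerOf-fixes {φ} (φN≡φ , BN≐B) rewrite ¬̃-involutive φ = cong ¬̃ φN≡φ , BN≐B

    innerOf-narrowing : IsNarrowing N → IsNarrowing (innerOf N)
    innerOf-narrowing n = record
      { contractance = λ φ → contractance (¬̃ φ)
      ; soundness    = λ φ B d d∈B → ⟦ψ⟧⇔⟦¬̃φ⟧⇒⟦¬̃ψ⟧⇔⟦φ⟧ φ (proj₁ (N (¬̃ φ , B))) d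
                                                           (soundness (¬̃ φ) B d d∈B)
      ; monotonicity = λ φ → monotonicity (¬̃ φ)
      ; idempotence  = λ φ B → innerOf-fixes (idempotence (¬̃ φ) B)
      }
      where open IsNarrowing n

    outer⇒innerOf-inner : IsOuterNarrowing N → IsInnerNarrowing (innerOf N)
    outer⇒innerOf-inner o = record
      { narrowing = innerOf-narrowing narrowing
      ; inner     = λ φ B d d∈B ¬φd → outer (¬̃ φ) B d d∈B (from (⟦¬̃⟧⇔¬⟦⟧ φ d) ¬φd)
      }
      where open IsOuterNarrowing o

    inner⇒innerOf-outer : IsInnerNarrowing N → IsOuterNarrowing (innerOf N)
    inner⇒innerOf-outer i = record
      { narrowing = innerOf-narrowing narrowing
      ; outer     = λ φ B d d∈B φd →
                      inner (¬̃ φ) B d d∈B (λ ¬̃φd → to (⟦¬̃⟧⇔¬⟦⟧ φ d) ¬̃φd φd)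
      }
      where open IsInnerNarrowing i

theorem1 : ExcludedMiddle 0ℓ →
    (O : StrictTotalOrder 0ℓ 0ℓ 0ℓ) (V : Set) (_≟V_ : DecidableEquality V) →
    let open Constraints O V _≟V_ in
    (No : BoundedConstraint → BoundedConstraint) →
    IsOuterNarrowing No ⇔ IsInnerNarrowing (innerOf No)
theorem1 em O V _≟V_ No =
  mk⇔ outer⇒innerOf-inner
      (IsOuterNarrowing-resp-≗ (innerOf-involutive No) ∘ inner⇒innerOf-outer)
  where
  open Opposite em O V _≟V_
  open Narrowing O V _≟V_
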